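{- Let $d\ge 2$ and $n,k\ge 0$ be integers. Then $N_d(n,k)$ equals the number of Dyck paths in $\mathcal{Q}_d$ with semilength $(d-1)(n-k)+k+1$ and exactly $k+1$ peaks.
   Context: $N_d(n,k) = \frac{1}{n+1} \binom{n+1}{k+1} \binom{ n + (n-k)(d-2)+1}{k}$. A Dyck path is a lattice path from $(0,0)$ with up steps $U=(1,1)$ and down steps $D=(1,-1)$, never going below the $x$-axis and ending on it at $(2m,0)$; $m$ is its semilength. An ascent is a maximal run of consecutive up steps; a peak is an occurrence of $UD$. $\mathcal{Q}_d$ is the set of nonempty Dyck paths in which every ascent has length congruent to $1$ modulo $d-1$. -}

module Defs where

open import Data.Nat using (ℕ; zero; suc; _+_; _*_; _∸_; _≡ᵇ_; _<ᵇ_)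
open import Data.Nat.DivMod using (_/_; _%_)
open import Data.Nat.Combinatorics using (_C_)
open import Data.Bool using (Bool; true; false; _∧_; not)
open import Data.List using (List; []; _∷_; length; map; filter; concatMap)
open import Relation.Nullary.Decidable using (Dec)
open import Data.Bool.Properties using (T?)
open import Data.Bool using (T)

data Step : Set where
  U D : Step

-- N_d(n,k) = 1/(n+1) * C(n+1,k+1) * C(n + (n-k)(d-2) + 1, k)
-- (the product is divisible by n+1; when k > n the factor C(n+1,k+1) is 0,
--  so the truncated subtraction n ∸ k in the second binomial is irrelevant)
N : ℕ → ℕ → ℕ → ℕ
N d n k = (((suc n) C (suc k)) * ((n + (n ∸ k) * (d ∸ 2) + 1) C k)) / suc n

allSeqs : ℕ → List (List Step)
allSeqs zero = [] ∷ []
allSeqs (suc l) = concatMap (λ s → (U ∷ s) ∷ (D ∷ s) ∷ []) (allSeqs l)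

dyckFrom : ℕ → List Step → Bool
dyckFrom h [] = h ≡ᵇ 0
dyckFrom h (U ∷ s) = dyckFrom (suc h) s
dyckFrom zero (D ∷ s) = false
dyckFrom (suc h) (D ∷ s) = dyckFrom h s

isDyck : List Step → Bool
isDyck s = dyckFrom 0 s

peaks : List Step → ℕ
peaks [] = 0
peaks (U ∷ D ∷ s) = suc (peaks (D ∷ s))
peaks (_ ∷ s) = peaks s

-- lengths of the ascents (maximal runs of U), in order
-- ascentsAux r s : r = length of the run of U's currently being read
ascentsAux : ℕ → List Step → List ℕ
ascentsAux zero [] = []
ascentsAux (suc r) [] = suc r ∷ []
ascentsAux r (U ∷ s) = ascentsAux (suc r) s
ascentsAux zero (D ∷ s) = ascentsAux zero s
ascentsAux (suc r) (D ∷ s) = suc r ∷ ascentsAux zero s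

ascents : List Step → List ℕ
ascents s = ascentsAux 0 s

allB : (ℕ → Bool) → List ℕ → Bool
allB p [] = true
allB p (x ∷ xs) = p x ∧ allB p xs

nonEmpty : List Step → Bool
nonEmpty [] = false
nonEmpty (_ ∷ _) = true

-- membership in Q_d: nonempty Dyck path, every ascent length ≡ 1 (mod d-1)
-- (for d ≥ 2, so d - 1 ≥ 1; we compare a % (d-1) with 1 % (d-1), which
--  handles d = 2 where every length is ≡ 1 mod 1)
inQ : (d : ℕ) → List Step → Bool
inQ zero s = false
inQ (suc zero) s = false
inQ (suc (suc e)) s =
  isDyck s ∧ nonEmpty s ∧ allB (λ a → (a % suc e) ≡ᵇ (1 % suc e)) (ascents s)

countQ : (d m p : ℕ) → ℕ
countQ d m p = length (filter (λ s → T? (inQ d s ∧ (peaks s ≡ᵇ p))) (allSeqs (2 * m)))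

open import Data.Integer using (ℤ; +_; -[1+_])

countQℤ : (d : ℕ) → ℤ → ℕ → ℕ
countQℤ d (+ m) p = countQ d m p
countQℤ d -[1+ _ ] p = 0

-- A word is read letter by letter by a recogniser whose state is (height, length of the ascent being
-- read, peaks still to come).  Since an ascent may only end when its length is ≡ 1 (mod d − 1), every
-- ascent is one up step followed by blocks of d − 1 up steps, and counting accepted words block by block
-- gives a recursion in the number p of peaks still to come, the height h, and the number t of blocks
-- still to place.  It has the ballot-type solution
--   (p + h + 1 + (d−1)t) · F = (h + 1) · C(p + h + 1 + (d−1)t, p) · C(t + p − 1, t),
-- proved by induction from Pascal's rule and the absorption identity.  At height 0 with k + 1 peaks
-- and t = n − k blocks this gives C(m, k) C(n, k) / (k + 1) with m = (d−1)(n−k) + k + 1, which is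
-- N_d(n, k).  When k > n both sides vanish: k + 1 peaks need semilength at least k + 1.

module Submission where

open import Defs
open import Data.Bool using (Bool; true; false; _∧_; if_then_else_)
open import Data.Bool.Properties using (T?; ∧-zeroʳ; T-≡)
open import Data.List using (List; []; _∷_; length; filter; concatMap)
open import Data.Nat
open import Data.Nat.Combinatorics using (_C_; nCk+nC[k+1]≡[n+1]C[k+1]; k>n⇒nCk≡0; nCn≡1; nC1≡n)
open import Data.Nat.DivMod using (_%_; _/_; [m+n]%n≡m%n; m<n⇒m%n≡m; n%n≡0; m*n/n≡m; 0/n≡0)
open import Data.Nat.Properties
open import Data.Nat.Tactic.RingSolver using (solve-∀)
open import Data.Product using (_,_)
open import Data.Sum using (inj₁; inj₂)
open import Function using (_∘_)
open import Function.Bundles using (Equivalence)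
open import Relation.Binary.PropositionalEquality

count : {A : Set} → (A → Bool) → List A → ℕ
count P [] = 0
count P (x ∷ xs) = if P x then suc (count P xs) else count P xs

length-filter-T? : {A : Set} (P : A → Bool) (xs : List A) →
  length (filter (T? ∘ P) xs) ≡ count P xs
length-filter-T? P [] = refl
length-filter-T? P (x ∷ xs) with P x
... | true = cong suc (length-filter-T? P xs)
... | false = length-filter-T? P xs

count-cong : {A : Set} {P Q : A → Bool} → (∀ x → P x ≡ Q x) → ∀ xs → count P xs ≡ count Q xs
count-cong eq [] = refl
count-cong {Q = Q} eq (x ∷ xs) rewrite eq x with Q x
... | true = cong suc (count-cong eq xs)
... | false = count-cong eq xs

count-allSeqs-suc : (P : List Step → Bool) (l : ℕ) →
  count P (allSeqs (suc l)) ≡ count (P ∘ (U ∷_)) (allSeqs l) + count (P ∘ (D ∷_)) (allSeqs l)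
count-allSeqs-suc P l = count-concatMap-UD (allSeqs l)
  where
  count-concatMap-UD : ∀ ws →
    count P (concatMap (λ w → (U ∷ w) ∷ (D ∷ w) ∷ []) ws) ≡ count (P ∘ (U ∷_)) ws + count (P ∘ (D ∷_)) ws
  count-concatMap-UD [] = refl
  count-concatMap-UD (w ∷ ws) with P (U ∷ w) | P (D ∷ w) | count-concatMap-UD ws
  ... | true  | true  | ih = cong suc (trans (cong suc ih) (sym (+-suc _ _)))
  ... | true  | false | ih = cong suc ih
  ... | false | true  | ih = trans (cong suc ih) (sym (+-suc _ _))
  ... | false | false | ih = ih

count-allSeqs-reject : (P : List Step → Bool) (l : ℕ) →
  (∀ w → length w ≡ l → P w ≡ false) → count P (allSeqs l) ≡ 0
count-allSeqs-reject P zero rej rewrite rej [] refl = refl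
count-allSeqs-reject P (suc l) rej = begin
  count P (allSeqs (suc l))                                   ≡⟨ count-allSeqs-suc P l ⟩
  count (P ∘ (U ∷_)) (allSeqs l) + count (P ∘ (D ∷_)) (allSeqs l)
    ≡⟨ cong₂ _+_ (count-allSeqs-reject (P ∘ (U ∷_)) l (λ w eq → rej (U ∷ w) (cong suc eq)))
                 (count-allSeqs-reject (P ∘ (D ∷_)) l (λ w eq → rej (D ∷ w) (cong suc eq))) ⟩
  0                                                           ∎
  where open ≡-Reasoning

nC0≡1 : ∀ n → n C 0 ≡ 1
nC0≡1 zero = refl
nC0≡1 (suc n) = refl

[1+n]*nCk≡[1+k]*[1+n]C[1+k] : ∀ n k → suc n * (n C k) ≡ suc k * (suc n C suc k)
[1+n]*nCk≡[1+k]*[1+n]C[1+k] zero zero = refl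
[1+n]*nCk≡[1+k]*[1+n]C[1+k] zero (suc k) = begin
  1 * (0 C suc k)          ≡⟨ cong (1 *_) (k>n⇒nCk≡0 {0} {suc k} z<s) ⟩
  0                        ≡⟨ *-zeroʳ (2 + k) ⟨
  (2 + k) * 0              ≡⟨ cong ((2 + k) *_) (k>n⇒nCk≡0 {1} {2 + k} (s<s z<s)) ⟨
  (2 + k) * (1 C (2 + k))  ∎
  where open ≡-Reasoning
[1+n]*nCk≡[1+k]*[1+n]C[1+k] (suc n) zero = begin
  (2 + n) * (suc n C 0)  ≡⟨ cong ((2 + n) *_) (nC0≡1 (suc n)) ⟩
  (2 + n) * 1            ≡⟨ *-identityʳ (2 + n) ⟩
  2 + n                  ≡⟨ nC1≡n (2 + n) ⟨
  (2 + n) C 1            ≡⟨ *-identityˡ _ ⟨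
  1 * ((2 + n) C 1)      ∎
  where open ≡-Reasoning
[1+n]*nCk≡[1+k]*[1+n]C[1+k] (suc n) (suc k) = begin
  (2 + n) * (suc n C suc k)          ≡⟨ cong ((2 + n) *_) (nCk+nC[k+1]≡[n+1]C[k+1] n k) ⟨
  (2 + n) * (A + B)                  ≡⟨ distribute n A B ⟩
  suc n * A + suc n * B + (A + B)
    ≡⟨ cong₂ (λ a b → a + b + (A + B)) ([1+n]*nCk≡[1+k]*[1+n]C[1+k] n k) ([1+n]*nCk≡[1+k]*[1+n]C[1+k] n (suc k)) ⟩
  suc k * X + (2 + k) * Y + (A + B)  ≡⟨ cong (λ z → suc k * X + (2 + k) * Y + z) (nCk+nC[k+1]≡[n+1]C[k+1] n k) ⟩
  suc k * X + (2 + k) * Y + X        ≡⟨ collect k X Y ⟩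
  (2 + k) * (X + Y)                  ≡⟨ cong ((2 + k) *_) (nCk+nC[k+1]≡[n+1]C[k+1] (suc n) (suc k)) ⟩
  (2 + k) * ((2 + n) C (2 + k))      ∎
  where
  open ≡-Reasoning
  A = n C k
  B = n C suc k
  X = suc n C suc k
  Y = suc n C (2 + k)
  distribute : ∀ n a b → (2 + n) * (a + b) ≡ suc n * a + suc n * b + (a + b)
  distribute = solve-∀
  collect : ∀ k x y → suc k * x + (2 + k) * y + x ≡ (2 + k) * (x + y)
  collect = solve-∀

[1+k+r]*[k+r]C[1+k]≡r*[1+k+r]C[1+k] : ∀ k r → suc (k + r) * ((k + r) C suc k) ≡ r * (suc (k + r) C suc k)
[1+k+r]*[k+r]C[1+k]≡r*[1+k+r]C[1+k] k r = sym (+-cancelˡ-≡ (suc k * X) (r * X) (suc n * B) (begin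
  suc k * X + r * X                ≡⟨ cong (λ x → suc k * x + r * x) (sym (nCk+nC[k+1]≡[n+1]C[k+1] n k)) ⟩
  suc k * (A + B) + r * (A + B)    ≡⟨ regroup k r A B ⟩
  suc n * A + suc n * B            ≡⟨ cong (_+ suc n * B) ([1+n]*nCk≡[1+k]*[1+n]C[1+k] n k) ⟩
  suc k * X + suc n * B            ∎))
  where
  open ≡-Reasoning
  n = k + r
  A = n C k
  B = n C suc k
  X = suc n C suc k
  regroup : ∀ k r a b → suc k * (a + b) + r * (a + b) ≡ suc (k + r) * a + suc (k + r) * b
  regroup = solve-∀

r*[k+r]Ck≡[1+k]*[k+r]C[1+k] : ∀ k r → r * ((k + r) C k) ≡ suc k * ((k + r) C suc k)
r*[k+r]Ck≡[1+k]*[k+r]C[1+k] k r = *-cancelˡ-≡ _ _ (suc n) (begin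
  suc n * (r * (n C k))              ≡⟨ swap (suc n) r (n C k) ⟩
  r * (suc n * (n C k))              ≡⟨ cong (r *_) ([1+n]*nCk≡[1+k]*[1+n]C[1+k] n k) ⟩
  r * (suc k * (suc n C suc k))      ≡⟨ swap r (suc k) (suc n C suc k) ⟩
  suc k * (r * (suc n C suc k))      ≡⟨ cong (suc k *_) ([1+k+r]*[k+r]C[1+k]≡r*[1+k+r]C[1+k] k r) ⟨
  suc k * (suc n * (n C suc k))      ≡⟨ swap (suc k) (suc n) (n C suc k) ⟩
  suc n * (suc k * (n C suc k))      ∎)
  where
  open ≡-Reasoning
  n = k + r
  swap : ∀ a b c → a * (b * c) ≡ b * (a * c)
  swap = solve-∀

multichoose : ℕ → ℕ → ℕ
multichoose zero zero = 1
multichoose zero (suc t) = 0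
multichoose (suc p) t = (t + p) C p

multichoose-zeroʳ : ∀ p → multichoose p 0 ≡ 1
multichoose-zeroʳ zero = refl
multichoose-zeroʳ (suc p) = nCn≡1 p

multichoose-pascal : ∀ p t → multichoose (suc p) (suc t) ≡ multichoose (suc p) t + multichoose p (suc t)
multichoose-pascal zero t = refl
multichoose-pascal (suc p) t = begin
  (suc t + suc p) C suc p                  ≡⟨ nCk+nC[k+1]≡[n+1]C[k+1] (t + suc p) p ⟨
  (t + suc p) C p + (t + suc p) C suc p    ≡⟨ +-comm ((t + suc p) C p) _ ⟩
  (t + suc p) C suc p + (t + suc p) C p    ≡⟨ cong (λ n → (t + suc p) C suc p + n C p) (+-suc t p) ⟩
  (t + suc p) C suc p + (suc t + p) C p    ∎
  where open ≡-Reasoning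

[1+t]*multichoose≡p*multichoose : ∀ p t → suc t * multichoose p (suc t) ≡ p * multichoose (suc p) t
[1+t]*multichoose≡p*multichoose zero t = *-zeroʳ (suc t)
[1+t]*multichoose≡p*multichoose (suc p) t = begin
  suc t * ((suc t + p) C p)        ≡⟨ cong (λ n → suc t * (n C p)) (+-comm (suc t) p) ⟩
  suc t * ((p + suc t) C p)        ≡⟨ r*[k+r]Ck≡[1+k]*[k+r]C[1+k] p (suc t) ⟩
  suc p * ((p + suc t) C suc p)    ≡⟨ cong (λ n → suc p * (n C suc p)) (trans (+-suc p t) (cong suc (+-comm p t))) ⟩
  suc p * ((suc t + p) C suc p)    ≡⟨ cong (λ n → suc p * (n C suc p)) (+-suc t p) ⟨
  suc p * ((t + suc p) C suc p)    ∎
  where open ≡-Reasoning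

[1+n]C[1+k]*a/[1+n]≡x : ∀ n k a x → suc k * x ≡ a * (n C k) → ((suc n C suc k) * a) / suc n ≡ x
[1+n]C[1+k]*a/[1+n]≡x n k a x hyp = trans (cong (_/ suc n) product) (m*n/n≡m x (suc n))
  where
  open ≡-Reasoning
  swap : ∀ a b c → a * (b * c) ≡ b * (a * c)
  swap = solve-∀
  product : (suc n C suc k) * a ≡ x * suc n
  product = *-cancelˡ-≡ _ _ (suc k) (begin
    suc k * ((suc n C suc k) * a)    ≡⟨ *-assoc (suc k) (suc n C suc k) a ⟨
    (suc k * (suc n C suc k)) * a    ≡⟨ cong (_* a) ([1+n]*nCk≡[1+k]*[1+n]C[1+k] n k) ⟨
    (suc n * (n C k)) * a            ≡⟨ trans (*-assoc (suc n) (n C k) a) (cong (suc n *_) (*-comm (n C k) a)) ⟩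
    suc n * (a * (n C k))            ≡⟨ cong (suc n *_) hyp ⟨
    suc n * (suc k * x)              ≡⟨ trans (swap (suc n) (suc k) x) (cong (suc k *_) (*-comm (suc n) x)) ⟩
    suc k * (x * suc n)              ∎)

module Automaton (e : ℕ) where

  goodAscent : ℕ → Bool
  goodAscent a = a % suc e ≡ᵇ 1 % suc e

  goodAscent-1 : goodAscent 1 ≡ true
  goodAscent-1 = Equivalence.to T-≡ (≡⇒≡ᵇ (1 % suc e) (1 % suc e) refl)

  goodAscent-+period : ∀ a → goodAscent (a + suc e) ≡ goodAscent a
  goodAscent-+period a = cong (_≡ᵇ 1 % suc e) ([m+n]%n≡m%n a (suc e))

  goodAscent-inside-period : ∀ a → 2 ≤ a → a ≤ suc e → goodAscent a ≡ false
  goodAscent-inside-period = inside-period e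
    where
    inside-period : ∀ n a → 2 ≤ a → a ≤ suc n → (a % suc n ≡ᵇ 1 % suc n) ≡ false
    inside-period n 1 (s≤s ()) _
    inside-period zero (suc (suc r)) _ (s≤s ())
    inside-period (suc n) (suc (suc r)) _ a≤ with m≤n⇒m<n∨m≡n a≤
    ... | inj₁ a<   = cong (_≡ᵇ 1) (m<n⇒m%n≡m a<)
    ... | inj₂ refl = cong (_≡ᵇ 1) (n%n≡0 (suc (suc n)))

  peaksAfterRun : ℕ → List Step → ℕ
  peaksAfterRun zero w = peaks w
  peaksAfterRun (suc r) w = peaks (U ∷ w)

  -- State: height h, length r of the ascent being read (0 right after a D),
  -- number p of peaks still to come.
  accepts : (h r p : ℕ) → List Step → Bool
  accepts h r p [] = ((h ≡ᵇ 0) ∧ allB goodAscent (ascentsAux r [])) ∧ (peaksAfterRun r [] ≡ᵇ p)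
  accepts h r p (U ∷ w) = accepts (suc h) (suc r) p w
  accepts zero r p (D ∷ w) = false
  accepts (suc h) zero p (D ∷ w) = accepts h 0 p w
  accepts (suc h) (suc r) zero (D ∷ w) = false
  accepts (suc h) (suc r) (suc p) (D ∷ w) = goodAscent (suc r) ∧ accepts h 0 p w

  accepts-spec : ∀ h r p w →
    accepts h r p w ≡ (dyckFrom h w ∧ allB goodAscent (ascentsAux r w)) ∧ (peaksAfterRun r w ≡ᵇ p)
  accepts-spec h r p [] = refl
  accepts-spec h zero p (U ∷ w) = accepts-spec (suc h) 1 p w
  accepts-spec h (suc r) p (U ∷ w) = accepts-spec (suc h) (suc (suc r)) p w
  accepts-spec zero r p (D ∷ w) = refl
  accepts-spec (suc h) zero p (D ∷ w) = accepts-spec h 0 p w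
  accepts-spec (suc h) (suc r) zero (D ∷ w) = sym (∧-zeroʳ _)
  accepts-spec (suc h) (suc r) (suc p) (D ∷ w) with goodAscent (suc r)
  ... | true = accepts-spec h 0 p w
  ... | false = sym (cong (_∧ _) (∧-zeroʳ (dyckFrom h w)))

  inQ∧peaks≡accepts : ∀ k w → (inQ (suc (suc e)) w ∧ (peaks w ≡ᵇ suc k)) ≡ accepts 0 0 (suc k) w
  inQ∧peaks≡accepts k [] = refl
  inQ∧peaks≡accepts k (x ∷ w) = sym (accepts-spec 0 0 (suc k) (x ∷ w))

  -- A pending ascent needs only its closing D for its peak, and that D also counts towards h.
  runSlack : ℕ → ℕ
  runSlack zero = 0
  runSlack (suc _) = 2

  accepts-short : ∀ h r p w → runSlack r + length w < h + p + p → accepts h r p w ≡ false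
  accepts-short zero r zero [] ()
  accepts-short (suc h) r zero [] short = refl
  accepts-short h zero (suc p) [] short = ∧-zeroʳ _
  accepts-short h (suc r) (suc p) [] short = ∧-zeroʳ _
  accepts-short h zero p (U ∷ w) short = accepts-short (suc h) 1 p w (s≤s short)
  accepts-short h (suc r) p (U ∷ w) short =
    accepts-short (suc h) (suc (suc r)) p w (m≤n⇒m≤1+n (≤-trans (n≤1+n _) short))
  accepts-short zero r p (D ∷ w) short = refl
  accepts-short (suc h) zero p (D ∷ w) short = accepts-short h 0 p w (s≤s⁻¹ short)
  accepts-short (suc h) (suc r) zero (D ∷ w) short = refl
  accepts-short (suc h) (suc r) (suc p) (D ∷ w) short =
    trans (cong (goodAscent (suc r) ∧_) (accepts-short h 0 p w shorter)) (∧-zeroʳ _)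
    where
    shorter : length w < h + p + p
    shorter = s≤s⁻¹ (s≤s⁻¹ (subst (2 + length w <_) (+-suc-suc h p) (s≤s⁻¹ short)))
      where
      +-suc-suc : ∀ h p → h + suc p + suc p ≡ suc (suc (h + p + p))
      +-suc-suc = solve-∀

  accepts-no-peaks : ∀ h r w → accepts (suc h) (suc r) 0 w ≡ false
  accepts-no-peaks h r [] = refl
  accepts-no-peaks h r (U ∷ w) = accepts-no-peaks (suc h) (suc r) w
  accepts-no-peaks h r (D ∷ w) = refl

  accepts-bad-ascent : ∀ h r p w → goodAscent (suc r) ≡ false → accepts h (suc r) p (D ∷ w) ≡ false
  accepts-bad-ascent zero r p w bad = refl
  accepts-bad-ascent (suc h) r zero w bad = refl
  accepts-bad-ascent (suc h) r (suc p) w bad rewrite bad = refl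

  accepts-ascent-period : ∀ h r p w → accepts h (suc r) p w ≡ accepts h (suc r + suc e) p w
  accepts-ascent-period h r p [] rewrite goodAscent-+period (suc r) = refl
  accepts-ascent-period h r p (U ∷ w) = accepts-ascent-period (suc h) (suc r) p w
  accepts-ascent-period zero r p (D ∷ w) = refl
  accepts-ascent-period (suc h) r zero (D ∷ w) = refl
  accepts-ascent-period (suc h) r (suc p) (D ∷ w) rewrite goodAscent-+period (suc r) = refl

  #accepted : (l h r p : ℕ) → ℕ
  #accepted l h r p = count (accepts h r p) (allSeqs l)

  countQ≡#accepted : ∀ m k → countQ (suc (suc e)) m (suc k) ≡ #accepted (2 * m) 0 0 (suc k)
  countQ≡#accepted m k =
    trans (length-filter-T? _ (allSeqs (2 * m))) (count-cong (inQ∧peaks≡accepts k) (allSeqs (2 * m)))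

  #accepted-short : ∀ l h r p → runSlack r + l < h + p + p → #accepted l h r p ≡ 0
  #accepted-short l h r p short = count-allSeqs-reject (accepts h r p) l
    (λ w len≡l → accepts-short h r p w (subst (λ n → runSlack r + n < h + p + p) (sym len≡l) short))

  #accepted-no-peaks : ∀ l h r → #accepted l (suc h) (suc r) 0 ≡ 0
  #accepted-no-peaks l h r = count-allSeqs-reject _ l (λ w _ → accepts-no-peaks h r w)

  #accepted-suc : ∀ l h r p → #accepted (suc l) h r p ≡
    #accepted l (suc h) (suc r) p + count (λ w → accepts h r p (D ∷ w)) (allSeqs l)
  #accepted-suc l h r p = count-allSeqs-suc (accepts h r p) l

  #accepted-forced-up : ∀ l h r p → (∀ w → accepts h r p (D ∷ w) ≡ false) →
    #accepted (suc l) h r p ≡ #accepted l (suc h) (suc r) p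
  #accepted-forced-up l h r p dead = begin
    #accepted (suc l) h r p                                        ≡⟨ #accepted-suc l h r p ⟩
    #accepted l (suc h) (suc r) p + count (λ w → accepts h r p (D ∷ w)) (allSeqs l)
      ≡⟨ cong (#accepted l (suc h) (suc r) p +_) (count-allSeqs-reject _ l (λ w _ → dead w)) ⟩
    #accepted l (suc h) (suc r) p + 0                              ≡⟨ +-identityʳ _ ⟩
    #accepted l (suc h) (suc r) p                                  ∎
    where open ≡-Reasoning

  #accepted-ground : ∀ l p → #accepted (suc l) 0 0 p ≡ #accepted l 1 1 p
  #accepted-ground l p = #accepted-forced-up l 0 0 p (λ w → refl)

  #accepted-valley : ∀ l h p → #accepted (suc l) (suc h) 0 p ≡ #accepted l (2 + h) 1 p + #accepted l h 0 p
  #accepted-valley l h p = #accepted-suc l (suc h) 0 p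

  #accepted-peak : ∀ l h p → #accepted (suc l) (suc h) 1 (suc p) ≡ #accepted l (2 + h) 2 (suc p) + #accepted l h 0 p
  #accepted-peak l h p = trans (#accepted-suc l (suc h) 1 (suc p))
    (cong (#accepted l (2 + h) 2 (suc p) +_) (count-cong (λ w → cong (_∧ accepts h 0 p w) goodAscent-1) (allSeqs l)))

  #accepted-rise : ∀ l h r p → goodAscent (suc r) ≡ false → #accepted (suc l) h (suc r) p ≡ #accepted l (suc h) (2 + r) p
  #accepted-rise l h r p bad = #accepted-forced-up l h (suc r) p (λ w → accepts-bad-ascent h r p w bad)

  #accepted-climb : ∀ i l h r p → (∀ j → j < i → goodAscent (j + suc r) ≡ false) →
    #accepted (i + l) h (suc r) p ≡ #accepted l (i + h) (i + suc r) p
  #accepted-climb zero l h r p bad = refl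
  #accepted-climb (suc i) l h r p bad = begin
    #accepted (suc i + l) h (suc r) p              ≡⟨ #accepted-rise (i + l) h r p (bad 0 z<s) ⟩
    #accepted (i + l) (suc h) (2 + r) p            ≡⟨ #accepted-climb i l (suc h) (suc r) p bad′ ⟩
    #accepted l (i + suc h) (i + (2 + r)) p        ≡⟨ cong₂ (λ a b → #accepted l a b p) (+-suc i h) (+-suc i (suc r)) ⟩
    #accepted l (suc i + h) (suc i + suc r) p      ∎
    where
    open ≡-Reasoning
    bad′ : ∀ j → j < i → goodAscent (j + suc (suc r)) ≡ false
    bad′ j j<i = subst (λ a → goodAscent a ≡ false) (sym (+-suc j (suc r))) (bad (suc j) (s<s j<i))

  -- Ascent lengths 2, …, e+1 cannot end, so the next e steps are forced to be U;
  -- length e+2 then behaves like length 1.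
  #accepted-ascent-block : ∀ l h p → #accepted (e + l) h 2 p ≡ #accepted l (e + h) 1 p
  #accepted-ascent-block l h p = begin
    #accepted (e + l) h 2 p                  ≡⟨ #accepted-climb e l h 1 p inside ⟩
    #accepted l (e + h) (e + 2) p            ≡⟨ cong (λ r → #accepted l (e + h) r p) (+-comm e 2) ⟩
    #accepted l (e + h) (1 + suc e) p        ≡⟨ count-cong (accepts-ascent-period (e + h) 0 p) (allSeqs l) ⟨
    #accepted l (e + h) 1 p                  ∎
    where
    open ≡-Reasoning
    inside : ∀ j → j < e → goodAscent (j + 2) ≡ false
    inside j j<e = subst (λ a → goodAscent a ≡ false) (+-comm 2 j)
                         (goodAscent-inside-period (2 + j) (s≤s (s≤s z≤n)) (s≤s j<e))

module Blocks (e : ℕ) where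

  -- completions p h t counts the ways to finish a path from height h right after a D, with p peaks
  -- and t blocks of e+1 extra up steps still to place; ascentSum f h t = Σⱼ f (h + (e+1)j) (t − j)
  -- sums over the number j of blocks taken by the next ascent, which starts at height h.
  ascentSum : (ℕ → ℕ → ℕ) → ℕ → ℕ → ℕ
  ascentSum f h zero = f h zero
  ascentSum f h (suc t) = f h (suc t) + ascentSum f (h + suc e) t

  completions : ℕ → ℕ → ℕ → ℕ
  completions zero h t = multichoose 0 t
  completions (suc p) zero t = ascentSum (completions p) zero t
  completions (suc p) (suc h) t = ascentSum (completions p) (suc h) t + completions (suc p) h t

  -- p + width h t is one more than the number of down steps of such a completion.
  width : ℕ → ℕ → ℕ
  width h t = suc h + suc e * t

  CompletionsFormula : ℕ → ℕ → ℕ → Set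
  CompletionsFormula p h t =
    (p + width h t) * completions p h t ≡ suc h * (((p + width h t) C p) * multichoose p t)

  completions-formula-zero : ∀ h t → CompletionsFormula 0 h t
  completions-formula-zero h zero = begin
    (suc h + suc e * 0) * 1      ≡⟨ cong (λ x → (suc h + x) * 1) (*-zeroʳ (suc e)) ⟩
    (suc h + 0) * 1              ≡⟨ unit h ⟩
    suc h * 1                    ∎
    where
    open ≡-Reasoning
    unit : ∀ h → (suc h + 0) * 1 ≡ suc h * 1
    unit = solve-∀
  completions-formula-zero h (suc t) = begin
    width h (suc t) * 0                              ≡⟨ *-zeroʳ (width h (suc t)) ⟩
    0                                                ≡⟨ *-zeroʳ (suc h) ⟨
    suc h * 0                                        ≡⟨ cong (suc h *_) (*-zeroʳ (width h (suc t) C 0)) ⟨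
    suc h * ((width h (suc t) C 0) * 0)                ∎
    where open ≡-Reasoning

  module _ (q : ℕ) (formula-q : ∀ h t → CompletionsFormula q h t) where

    ascentSum-formula : ∀ t h → suc q * ((q + width h t) * ascentSum (completions q) h t) ≡
      (suc q * suc h + suc e * t) * (((q + width h t) C q) * multichoose (suc q) t)
    ascentSum-formula zero h = begin
      suc q * ((q + width h 0) * completions q h 0)      ≡⟨ cong (suc q *_) (formula-q h 0) ⟩
      suc q * (suc h * (B * multichoose q 0))            ≡⟨ cong (λ x → suc q * (suc h * (B * x))) multichoose-0 ⟩
      suc q * (suc h * (B * multichoose (suc q) 0))      ≡⟨ regroup q h e _ ⟩
      (suc q * suc h + suc e * 0) * (B * multichoose (suc q) 0) ∎
      where
      open ≡-Reasoning
      B = (q + width h 0) C q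
      multichoose-0 : multichoose q 0 ≡ multichoose (suc q) 0
      multichoose-0 = trans (multichoose-zeroʳ q) (sym (multichoose-zeroʳ (suc q)))
      regroup : ∀ q h e x → suc q * (suc h * x) ≡ (suc q * suc h + suc e * 0) * x
      regroup = solve-∀
    ascentSum-formula (suc t) h = begin
        suc q * (X * (completions q h (suc t) + ascentSum (completions q) (h + suc e) t))
      ≡⟨ distrib q X (completions q h (suc t)) (ascentSum (completions q) (h + suc e) t) ⟩
        suc q * (X * completions q h (suc t)) + suc q * (X * ascentSum (completions q) (h + suc e) t)
      ≡⟨ cong₂ (λ a b → suc q * a + b) (formula-q h (suc t)) shifted ⟩
        suc q * (suc h * (B * A)) + (suc q * suc (h + suc e) + suc e * t) * (B * C′)
      ≡⟨ regroup₁ q h e t B A C′ ⟩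
        P + suc e * (B * (q * C′))
      ≡⟨ cong (λ x → P + suc e * (B * x)) ([1+t]*multichoose≡p*multichoose q t) ⟨
        P + suc e * (B * (suc t * A))
      ≡⟨ regroup₂ q h e t B A C′ ⟩
        (suc q * suc h + suc e * suc t) * (B * (C′ + A))
      ≡⟨ cong (λ x → (suc q * suc h + suc e * suc t) * (B * x)) (multichoose-pascal q t) ⟨
        (suc q * suc h + suc e * suc t) * (B * multichoose (suc q) (suc t))
      ∎
      where
      open ≡-Reasoning
      X = q + width h (suc t)
      B = X C q
      A = multichoose q (suc t)
      C′ = multichoose (suc q) t
      P = suc q * suc h * B * C′ + suc q * suc h * B * A + suc e * suc t * B * C′
      width-shift : q + width (h + suc e) t ≡ X
      width-shift = shift q h e t
        where
        shift : ∀ q h e t → q + (suc (h + suc e) + suc e * t) ≡ q + (suc h + suc e * suc t)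
        shift = solve-∀
      shifted : suc q * (X * ascentSum (completions q) (h + suc e) t) ≡ (suc q * suc (h + suc e) + suc e * t) * (B * C′)
      shifted = subst (λ Y → suc q * (Y * ascentSum (completions q) (h + suc e) t) ≡
                             (suc q * suc (h + suc e) + suc e * t) * ((Y C q) * C′))
                      width-shift (ascentSum-formula t (h + suc e))
      distrib : ∀ q x a b → suc q * (x * (a + b)) ≡ suc q * (x * a) + suc q * (x * b)
      distrib = solve-∀
      regroup₁ : ∀ q h e t b a c → suc q * (suc h * (b * a)) + (suc q * suc (h + suc e) + suc e * t) * (b * c)
               ≡ (suc q * suc h * b * c + suc q * suc h * b * a + suc e * suc t * b * c) + suc e * (b * (q * c))
      regroup₁ = solve-∀
      regroup₂ : ∀ q h e t b a c → (suc q * suc h * b * c + suc q * suc h * b * a + suc e * suc t * b * c) + suc e * (b * (suc t * a))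
               ≡ (suc q * suc h + suc e * suc t) * (b * (c + a))
      regroup₂ = solve-∀

    completions-formula-step : ∀ h t H →
      (q + width h t) * H ≡ h * (((q + width h t) C suc q) * multichoose (suc q) t) →
      suc (q + width h t) * (ascentSum (completions q) h t + H) ≡
        suc h * ((suc (q + width h t) C suc q) * multichoose (suc q) t)
    completions-formula-step h t H hyp = *-cancelˡ-≡ _ _ n {{n-nonZero}} (*-cancelˡ-≡ _ _ (suc q) (begin
        suc q * (n * (suc n * (G + H)))
      ≡⟨ distrib q n G H ⟩
        suc n * (suc q * (n * G)) + suc n * (suc q * (n * H))
      ≡⟨ cong₂ (λ a b → suc n * a + suc n * (suc q * b)) (ascentSum-formula t h) hyp ⟩
        suc n * (W * (B₀ * M)) + suc n * (suc q * (h * (B₁ * M)))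
      ≡⟨ regroup₁ q h n B₁ B₀ M W ⟩
        suc q * h * M * (suc n * B₁) + W * M * (suc n * B₀)
      ≡⟨ cong₂ (λ a b → suc q * h * M * a + W * M * b)
               ([1+k+r]*[k+r]C[1+k]≡r*[1+k+r]C[1+k] q (width h t)) ([1+n]*nCk≡[1+k]*[1+n]C[1+k] n q) ⟩
        suc q * h * M * (width h t * B) + W * M * (suc q * B)
      ≡⟨ regroup₂ q h e t M B ⟩
        suc q * (n * (suc h * (B * M)))
      ∎))
      where
      open ≡-Reasoning
      n = q + width h t
      G = ascentSum (completions q) h t
      B = suc n C suc q
      B₁ = n C suc q
      B₀ = n C q
      M = multichoose (suc q) t
      W = suc q * suc h + suc e * t
      n-nonZero : NonZero n
      n-nonZero = >-nonZero (≤-trans (s≤s z≤n) (m≤n+m (width h t) q))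
      distrib : ∀ q n g h → suc q * (n * (suc n * (g + h))) ≡ suc n * (suc q * (n * g)) + suc n * (suc q * (n * h))
      distrib = solve-∀
      regroup₁ : ∀ q h n b₁ b₀ m w → suc n * (w * (b₀ * m)) + suc n * (suc q * (h * (b₁ * m))) ≡
                 suc q * h * m * (suc n * b₁) + w * m * (suc n * b₀)
      regroup₁ = solve-∀
      regroup₂ : ∀ q h e t m b → suc q * h * m * ((suc h + suc e * t) * b) + (suc q * suc h + suc e * t) * m * (suc q * b)
                 ≡ suc q * ((q + (suc h + suc e * t)) * (suc h * (b * m)))
      regroup₂ = solve-∀

    completions-formula-suc : ∀ h t → CompletionsFormula (suc q) h t
    completions-formula-suc zero t = begin
      suc (q + width 0 t) * ascentSum (completions q) 0 t         ≡⟨ cong (suc (q + width 0 t) *_) (+-identityʳ _) ⟨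
      suc (q + width 0 t) * (ascentSum (completions q) 0 t + 0)   ≡⟨ completions-formula-step 0 t 0 (*-zeroʳ (q + width 0 t)) ⟩
      1 * ((suc (q + width 0 t) C suc q) * multichoose (suc q) t) ∎
      where open ≡-Reasoning
    completions-formula-suc (suc h) t = completions-formula-step (suc h) t (completions (suc q) h t) previous
      where
      shift : suc q + width h t ≡ q + width (suc h) t
      shift = sym (+-suc q (suc h + suc e * t))
      previous : (q + width (suc h) t) * completions (suc q) h t ≡
                 suc h * (((q + width (suc h) t) C suc q) * multichoose (suc q) t)
      previous = subst (λ n → n * completions (suc q) h t ≡ suc h * ((n C suc q) * multichoose (suc q) t))
                       shift (completions-formula-suc h t)

  completions-formula : ∀ p h t → CompletionsFormula p h t
  completions-formula zero = completions-formula-zero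
  completions-formula (suc q) = completions-formula-suc q (completions-formula q)

module Counting (e : ℕ) where
  open Automaton e
  open Blocks e

  remaining : ℕ → ℕ → ℕ → ℕ
  remaining p h t = h + p + p + suc e * t + suc e * t

  #accepted-peakless : ∀ h t → #accepted (remaining 0 h t) h 0 0 ≡ completions 0 h t
  #accepted-peakless zero zero = cong (λ l → #accepted l 0 0 0) (empty e)
    where
    empty : ∀ e → 0 + 0 + 0 + suc e * 0 + suc e * 0 ≡ 0
    empty = solve-∀
  #accepted-peakless zero (suc t) = begin
    #accepted (remaining 0 0 (suc t)) 0 0 0   ≡⟨ cong (λ l → #accepted l 0 0 0) (unfold e t) ⟩
    #accepted (suc l) 0 0 0                   ≡⟨ #accepted-ground l 0 ⟩
    #accepted l 1 1 0                         ≡⟨ #accepted-no-peaks l 0 0 ⟩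
    0                                         ∎
    where
    open ≡-Reasoning
    l = t + e * suc t + suc e * suc t
    unfold : ∀ e t → 0 + 0 + 0 + suc e * suc t + suc e * suc t ≡ suc (t + e * suc t + suc e * suc t)
    unfold = solve-∀
  #accepted-peakless (suc h) t = begin
    #accepted (suc l) (suc h) 0 0                      ≡⟨ #accepted-valley l h 0 ⟩
    #accepted l (2 + h) 1 0 + #accepted l h 0 0
      ≡⟨ cong₂ _+_ (#accepted-no-peaks l (suc h) 0) (#accepted-peakless h t) ⟩
    completions 0 (suc h) t                            ∎
    where
    open ≡-Reasoning
    l = remaining 0 h t

  module _ (q : ℕ) (#accepted≡completions-q : ∀ h t → #accepted (remaining q h t) h 0 q ≡ completions q h t) where

    #accepted-ascent : ∀ t h → #accepted (suc (remaining q h t)) (suc h) 1 (suc q) ≡ ascentSum (completions q) h t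
    #accepted-ascent zero h = begin
      #accepted (suc l) (suc h) 1 (suc q)                   ≡⟨ #accepted-peak l h q ⟩
      #accepted l (2 + h) 2 (suc q) + #accepted l h 0 q
        ≡⟨ cong₂ _+_ (#accepted-short l (2 + h) 2 (suc q) short) (#accepted≡completions-q h 0) ⟩
      completions q h 0                                     ∎
      where
      open ≡-Reasoning
      l = remaining q h 0
      short : 2 + l < 2 + h + suc q + suc q
      short = subst₂ _<_ (cong (2 +_) (sym (drop-blocks h q e))) (sym (lift h q)) (n≤1+n _)
        where
        drop-blocks : ∀ h q e → h + q + q + suc e * 0 + suc e * 0 ≡ h + q + q
        drop-blocks = solve-∀
        lift : ∀ h q → 2 + h + suc q + suc q ≡ 2 + suc (suc (h + q + q))
        lift = solve-∀
    #accepted-ascent (suc t) h = begin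
      #accepted (suc l) (suc h) 1 (suc q)                   ≡⟨ #accepted-peak l h q ⟩
      #accepted l (2 + h) 2 (suc q) + #accepted l h 0 q     ≡⟨ cong₂ _+_ longer (#accepted≡completions-q h (suc t)) ⟩
      ascentSum (completions q) (h + suc e) t + completions q h (suc t)  ≡⟨ +-comm (ascentSum (completions q) (h + suc e) t) _ ⟩
      ascentSum (completions q) h (suc t)                   ∎
      where
      open ≡-Reasoning
      l = remaining q h (suc t)
      l′ = suc (remaining q (h + suc e) t)
      longer : #accepted l (2 + h) 2 (suc q) ≡ ascentSum (completions q) (h + suc e) t
      longer = begin
        #accepted l (2 + h) 2 (suc q)                ≡⟨ cong (λ n → #accepted n (2 + h) 2 (suc q)) (split e h q t) ⟩
        #accepted (e + l′) (2 + h) 2 (suc q)         ≡⟨ #accepted-ascent-block l′ (2 + h) (suc q) ⟩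
        #accepted l′ (e + (2 + h)) 1 (suc q)         ≡⟨ cong (λ h′ → #accepted l′ h′ 1 (suc q)) (raise e h) ⟩
        #accepted l′ (suc (h + suc e)) 1 (suc q)     ≡⟨ #accepted-ascent t (h + suc e) ⟩
        ascentSum (completions q) (h + suc e) t      ∎
        where
        split : ∀ e h q t → h + q + q + suc e * suc t + suc e * suc t ≡ e + suc (h + suc e + q + q + suc e * t + suc e * t)
        split = solve-∀
        raise : ∀ e h → e + (2 + h) ≡ suc (h + suc e)
        raise = solve-∀

  #accepted≡completions : ∀ p h t → #accepted (remaining p h t) h 0 p ≡ completions p h t
  #accepted≡completions zero = #accepted-peakless
  #accepted≡completions (suc q) zero t = begin
    #accepted (remaining (suc q) 0 t) 0 0 (suc q)      ≡⟨ cong (λ l → #accepted l 0 0 (suc q)) (unfold q e t) ⟩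
    #accepted (2 + remaining q 0 t) 0 0 (suc q)        ≡⟨ #accepted-ground (suc (remaining q 0 t)) (suc q) ⟩
    #accepted (suc (remaining q 0 t)) 1 1 (suc q)      ≡⟨ #accepted-ascent q (#accepted≡completions q) t 0 ⟩
    completions (suc q) 0 t                            ∎
    where
    open ≡-Reasoning
    unfold : ∀ q e t → 0 + suc q + suc q + suc e * t + suc e * t ≡ 2 + (0 + q + q + suc e * t + suc e * t)
    unfold = solve-∀
  #accepted≡completions (suc q) (suc h) t = begin
    #accepted (suc l) (suc h) 0 (suc q)                          ≡⟨ #accepted-valley l h (suc q) ⟩
    #accepted l (2 + h) 1 (suc q) + #accepted l h 0 (suc q)      ≡⟨ cong₂ _+_ ascent (#accepted≡completions (suc q) h t) ⟩
    completions (suc q) (suc h) t                                ∎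
    where
    open ≡-Reasoning
    l = remaining (suc q) h t
    ascent : #accepted l (2 + h) 1 (suc q) ≡ ascentSum (completions q) (suc h) t
    ascent = trans (cong (λ n → #accepted n (2 + h) 1 (suc q)) (unfold h q e t))
                   (#accepted-ascent q (#accepted≡completions q) t (suc h))
      where
      unfold : ∀ h q e t → h + suc q + suc q + suc e * t + suc e * t ≡ suc (suc h + q + q + suc e * t + suc e * t)
      unfold = solve-∀

  countQ≡completions : ∀ k t → countQ (suc (suc e)) (suc e * t + k + 1) (suc k) ≡ completions (suc k) 0 t
  countQ≡completions k t = begin
    countQ (suc (suc e)) m (suc k)                ≡⟨ countQ≡#accepted m k ⟩
    #accepted (2 * m) 0 0 (suc k)                 ≡⟨ cong (λ l → #accepted l 0 0 (suc k)) (double e k t) ⟩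
    #accepted (remaining (suc k) 0 t) 0 0 (suc k) ≡⟨ #accepted≡completions (suc k) 0 t ⟩
    completions (suc k) 0 t                       ∎
    where
    open ≡-Reasoning
    m = suc e * t + k + 1
    double : ∀ e k t → 2 * (suc e * t + k + 1) ≡ 0 + suc k + suc k + suc e * t + suc e * t
    double = solve-∀

  m≤k⇒countQ≡0 : ∀ m k → m ≤ k → countQ (suc (suc e)) m (suc k) ≡ 0
  m≤k⇒countQ≡0 m k m≤k = trans (countQ≡#accepted m k) (#accepted-short (2 * m) 0 0 (suc k) short)
    where
    short : 2 * m < suc k + suc k
    short = subst₂ _<_ (sym (double m)) (sym (+-suc (suc k) k)) (s≤s (m≤n⇒m≤1+n (+-mono-≤ m≤k m≤k)))
      where
      double : ∀ m → 2 * m ≡ m + m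
      double = solve-∀

  [1+k]*completions≡product : ∀ k t → suc k * completions (suc k) 0 t ≡ ((suc e * t + k + 1) C k) * ((k + t) C k)
  [1+k]*completions≡product k t = *-cancelˡ-≡ _ _ (suc m) (begin
    suc m * (suc k * c)                   ≡⟨ swap (suc m) (suc k) c ⟩
    suc k * (suc m * c)                   ≡⟨ cong (suc k *_) formula ⟩
    suc k * ((suc m C suc k) * X)         ≡⟨ *-assoc (suc k) (suc m C suc k) X ⟨
    (suc k * (suc m C suc k)) * X         ≡⟨ cong (_* X) ([1+n]*nCk≡[1+k]*[1+n]C[1+k] m k) ⟨
    (suc m * (m C k)) * X                 ≡⟨ *-assoc (suc m) (m C k) X ⟩
    suc m * ((m C k) * X)                 ≡⟨ cong (λ n → suc m * ((m C k) * (n C k))) (+-comm t k) ⟩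
    suc m * ((m C k) * ((k + t) C k))     ∎)
    where
    open ≡-Reasoning
    m = suc e * t + k + 1
    c = completions (suc k) 0 t
    X = (t + k) C k
    swap : ∀ a b c → a * (b * c) ≡ b * (a * c)
    swap = solve-∀
    peaks+width : ∀ e k t → suc k + (1 + suc e * t) ≡ suc (suc e * t + k + 1)
    peaks+width = solve-∀
    formula : suc m * c ≡ (suc m C suc k) * X
    formula = subst (λ n → n * c ≡ (n C suc k) * X) (peaks+width e k t)
                    (trans (completions-formula (suc k) 0 t) (*-identityˡ _))

open import Data.Integer as ℤ using (ℤ; +_; -[1+_])
open import Data.Integer.Properties using (pos-+; pos-*; +-injective)
import Data.Integer.Tactic.RingSolver as ℤ-Solver

semilength : ℕ → ℕ → ℕ → ℤ
semilength d n k = (+ d ℤ.- + 1) ℤ.* (+ n ℤ.- + k) ℤ.+ + k ℤ.+ + 1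

semilength-≤ : ∀ e k t → semilength (suc (suc e)) (k + t) k ≡ + (suc e * t + k + 1)
semilength-≤ e k t = begin
  + suc e ℤ.* (+ (k + t) ℤ.- + k) ℤ.+ + k ℤ.+ + 1        ≡⟨ cong (λ z → + suc e ℤ.* (z ℤ.- + k) ℤ.+ + k ℤ.+ + 1) (pos-+ k t) ⟩
  + suc e ℤ.* (+ k ℤ.+ + t ℤ.- + k) ℤ.+ + k ℤ.+ + 1     ≡⟨ cancel (+ suc e) (+ k) (+ t) (+ 1) ⟩
  + suc e ℤ.* + t ℤ.+ + k ℤ.+ + 1                       ≡⟨ cong (λ z → z ℤ.+ + k ℤ.+ + 1) (pos-* (suc e) t) ⟨
  + (suc e * t) ℤ.+ + k ℤ.+ + 1                         ≡⟨ cong (ℤ._+ + 1) (pos-+ (suc e * t) k) ⟨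
  + (suc e * t + k) ℤ.+ + 1                             ≡⟨ pos-+ (suc e * t + k) 1 ⟨
  + (suc e * t + k + 1)                                 ∎
  where
  open ≡-Reasoning
  cancel : ∀ E K T O → E ℤ.* (K ℤ.+ T ℤ.- K) ℤ.+ K ℤ.+ O ≡ E ℤ.* T ℤ.+ K ℤ.+ O
  cancel = ℤ-Solver.solve-∀

semilength-> : ∀ e n j → semilength (suc (suc e)) n (suc (n + j)) ℤ.+ + (suc e * suc j) ≡ + suc (suc (n + j))
semilength-> e n j = begin
  semilength (suc (suc e)) n (suc (n + j)) ℤ.+ + (suc e * suc j)
    ≡⟨ cong₂ (λ a b → + suc e ℤ.* (+ n ℤ.- a) ℤ.+ a ℤ.+ + 1 ℤ.+ b) k≡
             (trans (pos-* (suc e) (suc j)) (cong (λ z → + suc e ℤ.* z) (pos-+ 1 j))) ⟩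
  + suc e ℤ.* (+ n ℤ.- (+ 1 ℤ.+ (+ n ℤ.+ + j))) ℤ.+ (+ 1 ℤ.+ (+ n ℤ.+ + j)) ℤ.+ + 1 ℤ.+ + suc e ℤ.* (+ 1 ℤ.+ + j)
    ≡⟨ cancel (+ suc e) (+ n) (+ j) (+ 1) ⟩
  + 1 ℤ.+ (+ 1 ℤ.+ (+ n ℤ.+ + j))
    ≡⟨ cong (λ a → + 1 ℤ.+ a) k≡ ⟨
  + 1 ℤ.+ + suc (n + j)
    ≡⟨ pos-+ 1 (suc (n + j)) ⟨
  + suc (suc (n + j))
    ∎
  where
  open ≡-Reasoning
  k≡ : + suc (n + j) ≡ + 1 ℤ.+ (+ n ℤ.+ + j)
  k≡ = trans (pos-+ 1 (n + j)) (cong (λ z → + 1 ℤ.+ z) (pos-+ n j))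
  cancel : ∀ E N J O → E ℤ.* (N ℤ.- (O ℤ.+ (N ℤ.+ J))) ℤ.+ (O ℤ.+ (N ℤ.+ J)) ℤ.+ O ℤ.+ E ℤ.* (O ℤ.+ J)
                       ≡ O ℤ.+ (O ℤ.+ (N ℤ.+ J))
  cancel = ℤ-Solver.solve-∀

module _ (e : ℕ) where
  open Counting e
  open Blocks e

  N≡countQ-k≤n : ∀ k t → N (suc (suc e)) (k + t) k ≡ countQℤ (suc (suc e)) (semilength (suc (suc e)) (k + t) k) (suc k)
  N≡countQ-k≤n k t = begin
    N (suc (suc e)) (k + t) k
      ≡⟨ cong (λ x → ((suc (k + t) C suc k) * (x C k)) / suc (k + t)) binomial-top ⟩
    ((suc (k + t) C suc k) * (m C k)) / suc (k + t)
      ≡⟨ [1+n]C[1+k]*a/[1+n]≡x (k + t) k (m C k) (completions (suc k) 0 t) ([1+k]*completions≡product k t) ⟩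
    completions (suc k) 0 t
      ≡⟨ countQ≡completions k t ⟨
    countQ (suc (suc e)) m (suc k)
      ≡⟨ cong (λ z → countQℤ (suc (suc e)) z (suc k)) (semilength-≤ e k t) ⟨
    countQℤ (suc (suc e)) (semilength (suc (suc e)) (k + t) k) (suc k)
      ∎
    where
    open ≡-Reasoning
    m = suc e * t + k + 1
    binomial-top : k + t + (k + t ∸ k) * e + 1 ≡ m
    binomial-top = trans (cong (λ s → k + t + s * e + 1) (m+n∸m≡n k t)) (regroup e k t)
      where
      regroup : ∀ e k t → k + t + t * e + 1 ≡ suc e * t + k + 1
      regroup = solve-∀

  N≡countQ-n<k : ∀ n j → N (suc (suc e)) n (suc (n + j)) ≡
    countQℤ (suc (suc e)) (semilength (suc (suc e)) n (suc (n + j))) (suc (suc (n + j)))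
  N≡countQ-n<k n j = trans no-choice (sym (no-paths (semilength (suc (suc e)) n k) (semilength-> e n j)))
    where
    k = suc (n + j)
    no-choice : N (suc (suc e)) n k ≡ 0
    no-choice = trans (cong (λ x → (x * ((n + (n ∸ k) * e + 1) C k)) / suc n) (k>n⇒nCk≡0 (s≤s (s≤s (m≤m+n n j)))))
                      (0/n≡0 (suc n))
    no-paths : ∀ z → z ℤ.+ + (suc e * suc j) ≡ + suc k → countQℤ (suc (suc e)) z (suc k) ≡ 0
    no-paths (+ m) eq = m≤k⇒countQ≡0 m k (s≤s⁻¹ (subst (m <_) m+x≡1+k (m<m+n m z<s)))
      where
      m+x≡1+k : m + suc e * suc j ≡ suc k
      m+x≡1+k = +-injective (trans (pos-+ m (suc e * suc j)) eq)
    no-paths -[1+ _ ] eq = refl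

theorem3p3 : (d n k : ℕ) → 2 ≤ d →
    N d n k ≡ countQℤ d ((+ d ℤ.- + 1) ℤ.* (+ n ℤ.- + k) ℤ.+ + k ℤ.+ + 1) (suc k)
theorem3p3 (suc (suc e)) n k _ with ≤-<-connex k n
... | inj₁ k≤n with m≤n⇒∃[o]m+o≡n k≤n
...   | t , refl = N≡countQ-k≤n e k t
theorem3p3 (suc (suc e)) n k _ | inj₂ n<k with m≤n⇒∃[o]m+o≡n n<k
...   | j , refl = N≡countQ-n<k e n j
theorem3p3 (suc zero) n k (s≤s ())
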